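{- Let $1 \leq i < j \leq m$ and let $r$ be an integer. Then \[\kappa_r(\mathbf{x}_i, s_{i+1} \cdots s_{j-1}(\mathbf{x}_{i+1}))= \frac{\bar{\sigma}^{(r-1)}_{(n-1)(j-i)}(\mathbf{x}_i, \dots, \mathbf{x}_j)}{\bar{\sigma}^{(r)}_{(n-1)(j-i-1)}(\mathbf{x}_{i+1}, \dots, \mathbf{x}_j)}\] and \[s_i \cdots s_{j-1}(x_i^{(r)}) =\frac{x_j^{(r+j-i)}\,\bar{\sigma}_{(n-1)(j-i)}^{(r)}(\mathbf{x}_i, \dots, \mathbf{x}_j)}{\bar{\sigma}_{(n-1)(j-i)}^{(r-1)}(\mathbf{x}_i, \dots, \mathbf{x}_j)}.\] (When $j=i+1$ the word $s_{i+1}\cdots s_{j-1}$ is empty and acts as the identity.)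
   Context: Fix positive integers $n,m$. For $\mathbf{x}_1,\dots,\mathbf{x}_m\in\mathbb{R}_{>0}^n$ write $\mathbf{x}_i=(x_i^{(1)},\dots,x_i^{(n)})$; upper indices are read modulo $n$. Empty products equal $1$. Birational $R$-matrix: for $\mathbf{a}=(a_1,\dots,a_n),\mathbf{b}=(b_1,\dots,b_n)\in\mathbb{R}^n_{>0}$ (indices mod $n$) and an integer $r$, let $\kappa_r(\mathbf{a},\mathbf{b})=\sum_{p=r}^{r+n-1}\prod_{q=r+1}^{p}b_q\prod_{q=p+1}^{r+n-1}a_q$. Define $\eta(\mathbf{a},\mathbf{b})=(\mathbf{b}',\mathbf{a}')$ where $a'_r=a_{r-1}\kappa_{r-1}(\mathbf{a},\mathbf{b})/\kappa_r(\mathbf{a},\mathbf{b})$ and $b'_r=b_{r+1}\kappa_{r+1}(\mathbf{a},\mathbf{b})/\kappa_r(\mathbf{a},\mathbf{b})$. For $1\le i<m$, $s_i$ acts on $(\mathbf{x}_1,\dots,\mathbf{x}_m)$ by replacing the pair $(\mathbf{x}_i,\mathbf{x}_{i+1})$ with $\eta(\mathbf{x}_i,\mathbf{x}_{i+1})$ and leaving the other vectors unchanged. A word $s=s_{a_1}s_{a_2}\cdots s_{a_p}$ acts by applying $s_{a_p}$ first and $s_{a_1}$ last. We write $s(\mathbf{x}_1,\dots,\mathbf{x}_m)=(s(\mathbf{x}_1),\dots,s(\mathbf{x}_m))$ and $s(\mathbf{x}_i)=(s(x_i^{(1)}),\dots,s(x_i^{(n)}))$. Functions: for integers $k\ge0$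 and $r$, $\tau_k^{(r)}(\mathbf{x}_1,\dots,\mathbf{x}_m)=\sum x_{i_1}^{(r)}x_{i_2}^{(r-1)}\cdots x_{i_k}^{(r-k+1)}$ over $1\le i_1\le\dots\le i_k\le m$ with no value appearing more than $n-1$ times; $\tau_0^{(r)}=1$, and $\tau_k^{(r)}=0$ if $k<0$ or $k>m(n-1)$ (for an empty list, $\tau_0=1$, $\tau_k=0$ otherwise). $\sigma_k^{(r)}(\mathbf{x}_1,\dots,\mathbf{x}_m)=\sum_{i=0}^k x_1^{(r)}\cdots x_1^{(r-i+1)}\tau_{k-i}^{(r-i)}(\mathbf{x}_2,\dots,\mathbf{x}_m)$ and $\bar{\sigma}_k^{(r)}(\mathbf{x}_1,\dots,\mathbf{x}_m)=\sum_{i=0}^k \tau_{k-i}^{(r)}(\mathbf{x}_1,\dots,\mathbf{x}_{m-1})x_m^{(r-k+i)}x_m^{(r-k+i-1)}\cdots x_m^{(r-k+1)}$ ($i$ factors). The same functions of a consecutive subsequence $\mathbf{x}_i,\dots,\mathbf{x}_j$ are defined after relabeling.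
   Formalization: The vectors $\mathbf{x}_1,\dots,\mathbf{x}_m$ have positive rational coordinates rather than positive real ones. -}

module Defs where

open import Data.Nat as ℕ using (ℕ; zero; suc; _∸_; NonZero)
open import Data.Fin using (Fin; toℕ; fromℕ<)
open import Data.Integer as ℤ using (ℤ; +_)
open import Data.Integer.DivMod using (_%ℕ_; n%ℕd<d)
open import Data.Rational as ℚ using (ℚ; 0ℚ; 1ℚ; _+_; _*_; 1/_; ≢-nonZero)
open import Data.Rational.Properties using (_≟_)
open import Data.List using (List; []; _∷_; map)
open import Data.Product using (_×_; _,_; proj₁; proj₂)
open import Relation.Nullary using (yes; no)

-- A point of ℝ^n_{>0} (here: ℚ^n), coordinates indexed by Fin n.
Pt : ℕ → Set
Pt n = Fin n → ℚ

-- Coordinate with an integer upper index, read modulo n.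
at : {n : ℕ} .{{_ : NonZero n}} → Pt n → ℤ → ℚ
at {n} v r = v (fromℕ< (n%ℕd<d r n))

-- Total division; only ever applied to positive denominators.
_÷_ : ℚ → ℚ → ℚ
p ÷ q with q ≟ 0ℚ
... | yes _ = 0ℚ
... | no q≢0 = p * (1/_ q {{≢-nonZero q≢0}})

sumℕ : ℕ → (ℕ → ℚ) → ℚ
sumℕ zero f = 0ℚ
sumℕ (suc k) f = sumℕ k f + f k

prodℕ : ℕ → (ℕ → ℚ) → ℚ
prodℕ zero f = 1ℚ
prodℕ (suc k) f = prodℕ k f * f k

-- κ_r(a,b) = Σ_{p=r}^{r+n-1} Π_{q=r+1}^{p} b_q Π_{q=p+1}^{r+n-1} a_q ,  with p = r + t.
κ : (n : ℕ) .{{_ : NonZero n}} → ℤ → Pt n → Pt n → ℚ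
κ n r a b = sumℕ n (λ t →
    prodℕ t (λ u → at b (r ℤ.+ + 1 ℤ.+ + u))
  * prodℕ (n ∸ 1 ∸ t) (λ u → at a (r ℤ.+ + t ℤ.+ + 1 ℤ.+ + u)))

η : (n : ℕ) .{{_ : NonZero n}} → Pt n → Pt n → Pt n × Pt n
η n a b = b′ , a′
  where
  a′ : Pt n
  a′ c = let r = + toℕ c in
    (at a (r ℤ.- + 1) * κ n (r ℤ.- + 1) a b) ÷ κ n r a b
  b′ : Pt n
  b′ c = let r = + toℕ c in
    (at b (r ℤ.+ + 1) * κ n (r ℤ.+ + 1) a b) ÷ κ n r a b

-- Configurations (x_1, ..., x_m): position p ↦ x_p (1-based; values
-- outside 1..m are irrelevant and never used).
Config : ℕ → Set
Config n = ℕ → Pt n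

sAct : (n : ℕ) .{{_ : NonZero n}} → ℕ → Config n → Config n
sAct n k x p with p ℕ.≟ k | p ℕ.≟ suc k
... | yes _ | _ = proj₁ (η n (x k) (x (suc k)))
... | no _ | yes _ = proj₂ (η n (x k) (x (suc k)))
... | no _ | no _ = x p

-- A word s_{a_1} ... s_{a_p}, given as the list [a_1, ..., a_p];
-- s_{a_p} is applied first, s_{a_1} last.
actWord : (n : ℕ) .{{_ : NonZero n}} → List ℕ → Config n → Config n
actWord n [] x = x
actWord n (a ∷ w) x = sAct n a (actWord n w x)

seg : ℕ → ℕ → List ℕ
seg lo zero = []
seg lo (suc k) = lo ∷ seg (suc lo) k

-- τ_k^{(r)}(v_1,...,v_m): sum over 1 ≤ i_1 ≤ ... ≤ i_k ≤ m, each value at most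
-- n-1 times, of x_{i_1}^{(r)} x_{i_2}^{(r-1)} ... x_{i_k}^{(r-k+1)}.
-- Computed by splitting off the c = #(indices equal to 1) first factors.
τ : (n : ℕ) .{{_ : NonZero n}} → List (Pt n) → ℕ → ℤ → ℚ
τ n [] zero r = 1ℚ
τ n [] (suc k) r = 0ℚ
τ n (v ∷ vs) k r =
  sumℕ (suc (ℕ._⊓_ k (n ∸ 1))) (λ c →
    prodℕ c (λ t → at v (r ℤ.- + t)) * τ n vs (k ∸ c) (r ℤ.- + c))

σ̄ : (n : ℕ) .{{_ : NonZero n}} → List (Pt n) → Pt n → ℕ → ℤ → ℚ
σ̄ n vs w k r = sumℕ (suc k) (λ i →
  τ n vs (k ∸ i) r *
  prodℕ i (λ u → at w (r ℤ.- + k ℤ.+ + i ℤ.- + u)))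

σ̄seg : (n : ℕ) .{{_ : NonZero n}} → Config n → ℕ → ℕ → ℕ → ℤ → ℚ
σ̄seg n x lo hi k r = σ̄ n (map x (seg lo (hi ∸ lo))) (x hi) k r

-- Induction on j − i, with both formulas proved with their denominators multiplied out.
-- Suppose the second formula holds for y = s_{i+1}⋯s_{j−1}(x_{i+1}). In the sum κ_r(x_i, y)
-- every product y^{(r+1)}⋯y^{(r+t)} then telescopes to a run of coordinates of x_j times
-- σ̄^{(r+t)}/σ̄^{(r)} of the chain x_{i+1}, …, x_j. What remains is σ̄^{(r−1)} of the chain
-- x_i, …, x_j expanded by the number of leading indices of τ equal to i: the run of x_i
-- matches after reversing the order of summation and reading upper indices modulo n, and
-- past the top degree (n−1)(j−i−1) of τ the σ̄ of the shorter chain only picks up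
-- coordinates of x_j. As s_i⋯s_{j−1}(x_i) is the first component
-- of η(x_i, y), the second formula for x_i, …, x_j follows from the first by the definition
-- of η. Positivity is used only to know that the σ̄'s, and hence κ, do not vanish.

module Submission where

open import Data.Bool using (if_then_else_)
open import Data.Empty using (⊥-elim)
import Data.Empty.Irrelevant as Irrelevant
import Data.Fin.Properties as Finₚ
open import Data.Fin using (toℕ; fromℕ<)
open import Data.Integer as ℤ using (ℤ; +_; _⊖_)
open import Data.Integer.DivMod using (_%ℕ_; _/ℕ_; n%ℕd<d; a≡a%ℕn+[a/ℕn]*n)
import Data.Integer.Properties as ℤₚ
import Data.Integer.Tactic.RingSolver as ℤ-Solver
open import Data.List using (List; []; _∷_; length; map)
open import Data.List.Relation.Unary.All as All using (All; []; _∷_)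
open import Data.Maybe using (nothing)
open import Data.Nat as ℕ using (ℕ; zero; suc; _∸_; _⊓_; s≤s)
import Data.Nat.Properties as ℕₚ
open import Data.Product using (_,_; proj₁)
open import Data.Rational using (ℚ; 0ℚ; 1ℚ; 1/_; Positive; NonNegative; ≢-nonZero)
import Data.Rational.Properties as ℚₚ
open import Data.Sum using (inj₁; inj₂)
open import Function using (_∘_)
open import Level using (0ℓ)
open import Relation.Binary.PropositionalEquality
open import Relation.Nullary using (¬_; does; yes; no)
open import Relation.Nullary.Decidable using (dec-true; dec-false)
open import Tactic.RingSolver using (solve-∀)
open import Tactic.RingSolver.Core.AlmostCommutativeRing using (AlmostCommutativeRing; fromCommutativeRing)

open import Defs

ℚ-ring : AlmostCommutativeRing 0ℓ 0ℓ
ℚ-ring = fromCommutativeRing ℚₚ.+-*-commutativeRing (λ _ → nothing)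

infix 4 _≡_mod_

record _≡_mod_ (r s : ℤ) (m : ℕ) : Set where
  constructor mod-witness
  field
    quotient   : ℤ
    difference : r ≡ s ℤ.+ quotient ℤ.* + m

+-cong-mod : ∀ {r s m} c → r ≡ s mod m → r ℤ.+ c ≡ s ℤ.+ c mod m
+-cong-mod {s = s} {m} c (mod-witness q refl) = mod-witness q (shuffle s c q (+ m))
  where
  shuffle : ∀ s c q m → (s ℤ.+ q ℤ.* m) ℤ.+ c ≡ (s ℤ.+ c) ℤ.+ q ℤ.* m
  shuffle = ℤ-Solver.solve-∀

pos-∸ : ∀ {a b} → b ℕ.≤ a → + (a ∸ b) ≡ + a ℤ.- + b
pos-∸ {a} {b} b≤a = trans (sym (ℤₚ.⊖-≥ b≤a)) (sym (ℤₚ.m-n≡m⊖n a b))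

*-suc-∸-∸ : ∀ m k {t} → t ℕ.≤ m → m ℕ.* suc k ∸ (m ∸ t) ≡ t ℕ.+ m ℕ.* k
*-suc-∸-∸ m k {t} t≤m = begin
  m ℕ.* suc k ∸ (m ∸ t)        ≡⟨ cong (_∸ (m ∸ t)) (ℕₚ.*-suc m k) ⟩
  (m ℕ.+ m ℕ.* k) ∸ (m ∸ t)    ≡⟨ ℕₚ.+-∸-comm (m ℕ.* k) (ℕₚ.m∸n≤m m t) ⟩
  m ∸ (m ∸ t) ℕ.+ m ℕ.* k      ≡⟨ cong (ℕ._+ m ℕ.* k) (ℕₚ.m∸[m∸n]≡n t≤m) ⟩
  t ℕ.+ m ℕ.* k                ∎
  where open ≡-Reasoning

-- Finite sums and products

module _ where
  open import Data.Rational using (_+_; _*_)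
  open ≡-Reasoning

  sumℕ-cong : ∀ k {f g : ℕ → ℚ} → (∀ t → t ℕ.< k → f t ≡ g t) → sumℕ k f ≡ sumℕ k g
  sumℕ-cong zero    f≗g = refl
  sumℕ-cong (suc k) f≗g =
    cong₂ _+_ (sumℕ-cong k (λ t t<k → f≗g t (ℕₚ.m<n⇒m<1+n t<k))) (f≗g k (ℕₚ.n<1+n k))

  prodℕ-cong : ∀ k {f g : ℕ → ℚ} → (∀ t → t ℕ.< k → f t ≡ g t) → prodℕ k f ≡ prodℕ k g
  prodℕ-cong zero    f≗g = refl
  prodℕ-cong (suc k) f≗g =
    cong₂ _*_ (prodℕ-cong k (λ t t<k → f≗g t (ℕₚ.m<n⇒m<1+n t<k))) (f≗g k (ℕₚ.n<1+n k))

  sumℕ-first : ∀ k (f : ℕ → ℚ) → sumℕ (suc k) f ≡ f 0 + sumℕ k (f ∘ suc)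
  sumℕ-first zero    f = trans (ℚₚ.+-identityˡ (f 0)) (sym (ℚₚ.+-identityʳ (f 0)))
  sumℕ-first (suc k) f = trans (cong (_+ f (suc k)) (sumℕ-first k f)) (ℚₚ.+-assoc (f 0) _ _)

  prodℕ-first : ∀ k (f : ℕ → ℚ) → prodℕ (suc k) f ≡ f 0 * prodℕ k (f ∘ suc)
  prodℕ-first zero    f = trans (ℚₚ.*-identityˡ (f 0)) (sym (ℚₚ.*-identityʳ (f 0)))
  prodℕ-first (suc k) f = trans (cong (_* f (suc k)) (prodℕ-first k f)) (ℚₚ.*-assoc (f 0) _ _)

  sumℕ-reverse : ∀ k (f : ℕ → ℚ) → sumℕ k f ≡ sumℕ k (λ u → f (k ∸ suc u))
  sumℕ-reverse zero    f = refl
  sumℕ-reverse (suc k) f = begin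
    sumℕ k f + f k                       ≡⟨ cong (_+ f k) (sumℕ-reverse k f) ⟩
    sumℕ k (λ u → f (k ∸ suc u)) + f k   ≡⟨ ℚₚ.+-comm _ (f k) ⟩
    f k + sumℕ k (λ u → f (k ∸ suc u))   ≡⟨ sumℕ-first k (λ u → f (k ∸ u)) ⟨
    sumℕ (suc k) (λ u → f (k ∸ u))       ∎

  prodℕ-reverse : ∀ k (f : ℕ → ℚ) → prodℕ k f ≡ prodℕ k (λ u → f (k ∸ suc u))
  prodℕ-reverse zero    f = refl
  prodℕ-reverse (suc k) f = begin
    prodℕ k f * f k                       ≡⟨ cong (_* f k) (prodℕ-reverse k f) ⟩
    prodℕ k (λ u → f (k ∸ suc u)) * f k   ≡⟨ ℚₚ.*-comm _ (f k) ⟩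
    f k * prodℕ k (λ u → f (k ∸ suc u))   ≡⟨ prodℕ-first k (λ u → f (k ∸ u)) ⟨
    prodℕ (suc k) (λ u → f (k ∸ u))       ∎

  prodℕ-descending : ∀ (f : ℤ → ℚ) d a →
    prodℕ d (λ u → f (a ℤ.- + u)) ≡ prodℕ d (λ u → f (a ℤ.- + d ℤ.+ + 1 ℤ.+ + u))
  prodℕ-descending f d a = trans (prodℕ-reverse d _) (prodℕ-cong d (λ u u<d → cong f (begin
    a ℤ.- + (d ∸ suc u)         ≡⟨ cong (λ z → a ℤ.- z) (pos-∸ u<d) ⟩
    a ℤ.- (+ d ℤ.- + suc u)     ≡⟨ reindex a (+ d) (+ u) ⟩
    a ℤ.- + d ℤ.+ + 1 ℤ.+ + u   ∎)))
    where
    reindex : ∀ a d u → a ℤ.- (d ℤ.- (+ 1 ℤ.+ u)) ≡ a ℤ.- d ℤ.+ + 1 ℤ.+ u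
    reindex = ℤ-Solver.solve-∀

  *-distribˡ-sumℕ : ∀ c k (f : ℕ → ℚ) → c * sumℕ k f ≡ sumℕ k (λ t → c * f t)
  *-distribˡ-sumℕ c zero    f = ℚₚ.*-zeroʳ c
  *-distribˡ-sumℕ c (suc k) f =
    trans (ℚₚ.*-distribˡ-+ c (sumℕ k f) (f k)) (cong (_+ c * f k) (*-distribˡ-sumℕ c k f))

  *-distribʳ-sumℕ : ∀ c k (f : ℕ → ℚ) → sumℕ k f * c ≡ sumℕ k (λ t → f t * c)
  *-distribʳ-sumℕ c zero    f = ℚₚ.*-zeroˡ c
  *-distribʳ-sumℕ c (suc k) f =
    trans (ℚₚ.*-distribʳ-+ c (sumℕ k f) (f k)) (cong (_+ f k * c) (*-distribʳ-sumℕ c k f))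

  sumℕ-zero : ∀ k {f : ℕ → ℚ} → (∀ t → t ℕ.< k → f t ≡ 0ℚ) → sumℕ k f ≡ 0ℚ
  sumℕ-zero zero    f≡0 = refl
  sumℕ-zero (suc k) f≡0 =
    trans (cong₂ _+_ (sumℕ-zero k (λ t t<k → f≡0 t (ℕₚ.m<n⇒m<1+n t<k))) (f≡0 k (ℕₚ.n<1+n k)))
          (ℚₚ.+-identityʳ 0ℚ)

  sumℕ-+ : ∀ k (f g : ℕ → ℚ) → sumℕ k (λ t → f t + g t) ≡ sumℕ k f + sumℕ k g
  sumℕ-+ zero    f g = refl
  sumℕ-+ (suc k) f g =
    trans (cong (_+ (f k + g k)) (sumℕ-+ k f g)) (interchange (sumℕ k f) (sumℕ k g) (f k) (g k))
    where
    interchange : ∀ a b c d → (a + b) + (c + d) ≡ (a + c) + (b + d)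
    interchange = solve-∀ ℚ-ring

  sumℕ-comm : ∀ k l (g : ℕ → ℕ → ℚ) →
    sumℕ k (λ a → sumℕ l (g a)) ≡ sumℕ l (λ c → sumℕ k (λ a → g a c))
  sumℕ-comm zero    l g = sym (sumℕ-zero l (λ _ _ → refl))
  sumℕ-comm (suc k) l g =
    trans (cong (_+ sumℕ l (g k)) (sumℕ-comm k l g)) (sym (sumℕ-+ l _ (g k)))

  [_≤_]·_ : ℕ → ℕ → ℚ → ℚ
  [ a ≤ b ]· q = if does (a ℕ.≤? b) then q else 0ℚ

  [≤]·-holds : ∀ {a b} q → a ℕ.≤ b → [ a ≤ b ]· q ≡ q
  [≤]·-holds {a} {b} q a≤b rewrite dec-true (a ℕ.≤? b) a≤b = refl

  [≤]·-fails : ∀ {a b} q → ¬ a ℕ.≤ b → [ a ≤ b ]· q ≡ 0ℚ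
  [≤]·-fails {a} {b} q a≰b rewrite dec-false (a ℕ.≤? b) a≰b = refl

  ≤∸-swap : ∀ {a c k} → a ℕ.≤ k → c ℕ.≤ k ∸ a → a ℕ.≤ k ∸ c
  ≤∸-swap {a} {c} {k} a≤k c≤k∸a =
    ℕₚ.m+n≤o⇒m≤o∸n a (subst (ℕ._≤ k) (ℕₚ.+-comm c a) (ℕₚ.m≤o∸n⇒m+n≤o c a≤k c≤k∸a))

  [≤∸]·-swap : ∀ {a c k} q → a ℕ.≤ k → c ℕ.≤ k → [ c ≤ k ∸ a ]· q ≡ [ a ≤ k ∸ c ]· q
  [≤∸]·-swap {a} {c} {k} q a≤k c≤k with c ℕ.≤? k ∸ a
  ... | yes c≤k∸a = trans ([≤]·-holds q c≤k∸a) (sym ([≤]·-holds q (≤∸-swap a≤k c≤k∸a)))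
  ... | no  c≰k∸a = trans ([≤]·-fails q c≰k∸a) (sym ([≤]·-fails q (c≰k∸a ∘ ≤∸-swap {c} {a} {k} c≤k)))

  sumℕ-[≤] : ∀ {p q} (h : ℕ → ℚ) → p ℕ.≤ q →
    sumℕ (suc q) (λ a → [ a ≤ p ]· h a) ≡ sumℕ (suc p) h
  sumℕ-[≤] {p} h p≤q = go (ℕₚ.≤⇒≤′ p≤q)
    where
    go : ∀ {q} → p ℕ.≤′ q → sumℕ (suc q) (λ a → [ a ≤ p ]· h a) ≡ sumℕ (suc p) h
    go ℕ.≤′-refl = sumℕ-cong (suc p) (λ a a<1+p → [≤]·-holds (h a) (ℕₚ.≤-pred a<1+p))
    go (ℕ.≤′-step {q} p≤′q) =
      trans (cong₂ _+_ (go p≤′q) ([≤]·-fails (h (suc q)) (ℕₚ.<⇒≱ (s≤s (ℕₚ.≤′⇒≤ p≤′q)))))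
            (ℚₚ.+-identityʳ _)

  sumℕ-⊓ : ∀ q p (h : ℕ → ℚ) → sumℕ (suc (q ⊓ p)) h ≡ sumℕ (suc p) (λ c → [ c ≤ q ]· h c)
  sumℕ-⊓ q p h with ℕₚ.≤-total q p
  ... | inj₁ q≤p rewrite ℕₚ.m≤n⇒m⊓n≡m q≤p = sym (sumℕ-[≤] h q≤p)
  ... | inj₂ p≤q rewrite ℕₚ.m≥n⇒m⊓n≡n p≤q =
    sumℕ-cong (suc p) (λ c c<1+p → sym ([≤]·-holds (h c) (ℕₚ.≤-trans (ℕₚ.≤-pred c<1+p) p≤q)))

  sumℕ-triangle : ∀ {p} k (g : ℕ → ℕ → ℚ) → p ℕ.≤ k →
    sumℕ (suc k) (λ a → sumℕ (suc ((k ∸ a) ⊓ p)) (g a))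
      ≡ sumℕ (suc p) (λ c → sumℕ (suc (k ∸ c)) (λ a → g a c))
  sumℕ-triangle {p} k g p≤k = begin
    sumℕ (suc k) (λ a → sumℕ (suc ((k ∸ a) ⊓ p)) (g a))
      ≡⟨ sumℕ-cong (suc k) (λ a _ → sumℕ-⊓ (k ∸ a) p (g a)) ⟩
    sumℕ (suc k) (λ a → sumℕ (suc p) (λ c → [ c ≤ k ∸ a ]· g a c))
      ≡⟨ sumℕ-comm (suc k) (suc p) _ ⟩
    sumℕ (suc p) (λ c → sumℕ (suc k) (λ a → [ c ≤ k ∸ a ]· g a c))
      ≡⟨ sumℕ-cong (suc p) (λ c c<1+p → sumℕ-cong (suc k) (λ a a<1+k →
           [≤∸]·-swap (g a c) (ℕₚ.≤-pred a<1+k) (ℕₚ.≤-trans (ℕₚ.≤-pred c<1+p) p≤k))) ⟩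
    sumℕ (suc p) (λ c → sumℕ (suc k) (λ a → [ a ≤ k ∸ c ]· g a c))
      ≡⟨ sumℕ-cong (suc p) (λ c _ → sumℕ-[≤] (λ a → g a c) (ℕₚ.m∸n≤m k c)) ⟩
    sumℕ (suc p) (λ c → sumℕ (suc (k ∸ c)) (λ a → g a c)) ∎

  prodℕ-telescope : ∀ {f g h : ℕ → ℚ} → (∀ u → f u * h u ≡ g u * h (suc u)) →
    ∀ t → prodℕ t f * h 0 ≡ prodℕ t g * h t
  prodℕ-telescope         step zero    = refl
  prodℕ-telescope {f} {g} {h} step (suc t) = begin
    (prodℕ t f * f t) * h 0        ≡⟨ exchange (prodℕ t f) (f t) (h 0) ⟩
    (prodℕ t f * h 0) * f t        ≡⟨ cong (_* f t) (prodℕ-telescope step t) ⟩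
    (prodℕ t g * h t) * f t        ≡⟨ exchange (prodℕ t g) (h t) (f t) ⟩
    (prodℕ t g * f t) * h t        ≡⟨ ℚₚ.*-assoc (prodℕ t g) (f t) (h t) ⟩
    prodℕ t g * (f t * h t)        ≡⟨ cong (prodℕ t g *_) (step t) ⟩
    prodℕ t g * (g t * h (suc t))  ≡⟨ ℚₚ.*-assoc (prodℕ t g) (g t) (h (suc t)) ⟨
    (prodℕ t g * g t) * h (suc t)  ∎
    where
    exchange : ∀ a b c → (a * b) * c ≡ (a * c) * b
    exchange = solve-∀ ℚ-ring

  sumℕ-nonNegative : ∀ k {f : ℕ → ℚ} → (∀ t → NonNegative (f t)) → NonNegative (sumℕ k f)
  sumℕ-nonNegative zero    f≥0 = _
  sumℕ-nonNegative (suc k) {f} f≥0 =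
    ℚₚ.nonNeg+nonNeg⇒nonNeg (sumℕ k f) {{sumℕ-nonNegative k f≥0}} (f k) {{f≥0 k}}

  prodℕ-nonNegative : ∀ k {f : ℕ → ℚ} → (∀ t → NonNegative (f t)) → NonNegative (prodℕ k f)
  prodℕ-nonNegative zero    f≥0 = _
  prodℕ-nonNegative (suc k) {f} f≥0 =
    ℚₚ.nonNeg*nonNeg⇒nonNeg (prodℕ k f) {{prodℕ-nonNegative k f≥0}} (f k) {{f≥0 k}}

  prodℕ-positive : ∀ k {f : ℕ → ℚ} → (∀ t → Positive (f t)) → Positive (prodℕ k f)
  prodℕ-positive zero    f>0 = _
  prodℕ-positive (suc k) {f} f>0 =
    ℚₚ.pos*pos⇒pos (prodℕ k f) {{prodℕ-positive k f>0}} (f k) {{f>0 k}}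

  positive⇒≢0 : ∀ {q} → Positive q → q ≢ 0ℚ
  positive⇒≢0 {q} q>0 q≡0 = ℚₚ.<⇒≢ (ℚₚ.positive⁻¹ q {{q>0}}) (sym q≡0)

  ÷-≢0 : ∀ p {q} (q≢0 : q ≢ 0ℚ) → p ÷ q ≡ p * 1/_ q {{≢-nonZero q≢0}}
  ÷-≢0 p {q} q≢0 with q ℚₚ.≟ 0ℚ
  ... | yes q≡0 = ⊥-elim (q≢0 q≡0)
  ... | no  _   = refl

  ÷-*-cancel : ∀ p {q} → q ≢ 0ℚ → (p ÷ q) * q ≡ p
  ÷-*-cancel p {q} q≢0 = begin
    (p ÷ q) * q           ≡⟨ cong (_* q) (÷-≢0 p q≢0) ⟩
    (p * q⁻¹) * q         ≡⟨ ℚₚ.*-assoc p q⁻¹ q ⟩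
    p * (q⁻¹ * q)         ≡⟨ cong (p *_) (ℚₚ.*-inverseˡ q {{≢-nonZero q≢0}}) ⟩
    p * 1ℚ                ≡⟨ ℚₚ.*-identityʳ p ⟩
    p                     ∎
    where q⁻¹ = 1/_ q {{≢-nonZero q≢0}}

  ÷-unique : ∀ {p q z} → q ≢ 0ℚ → z * q ≡ p → p ÷ q ≡ z
  ÷-unique {p} {q} {z} q≢0 refl = begin
    (z * q) ÷ q           ≡⟨ ÷-≢0 (z * q) q≢0 ⟩
    (z * q) * q⁻¹         ≡⟨ ℚₚ.*-assoc z q q⁻¹ ⟩
    z * (q * q⁻¹)         ≡⟨ cong (z *_) (ℚₚ.*-inverseʳ q {{≢-nonZero q≢0}}) ⟩
    z * 1ℚ                ≡⟨ ℚₚ.*-identityʳ z ⟩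
    z                     ∎
    where q⁻¹ = 1/_ q {{≢-nonZero q≢0}}

  ratio-transfer : ∀ {b c k k′ B B′ A A′} → A ≢ 0ℚ →
    k * B ≡ A → k′ * B′ ≡ A′ → b * B ≡ c * B′ → ((b * k′) ÷ k) * A ≡ c * A′
  ratio-transfer {b} {c} {k} {k′} {B} {B′} {A} {A′} A≢0 kB≡A k′B′≡A′ bB≡cB′ = begin
    ((b * k′) ÷ k) * A        ≡⟨ cong (((b * k′) ÷ k) *_) kB≡A ⟨
    ((b * k′) ÷ k) * (k * B)  ≡⟨ ℚₚ.*-assoc ((b * k′) ÷ k) k B ⟨
    (((b * k′) ÷ k) * k) * B  ≡⟨ cong (_* B) (÷-*-cancel (b * k′) k≢0) ⟩
    (b * k′) * B              ≡⟨ exchange b k′ B ⟩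
    (b * B) * k′              ≡⟨ cong (_* k′) bB≡cB′ ⟩
    (c * B′) * k′             ≡⟨ reassoc c B′ k′ ⟩
    c * (k′ * B′)             ≡⟨ cong (c *_) k′B′≡A′ ⟩
    c * A′                    ∎
    where
    k≢0 : k ≢ 0ℚ
    k≢0 k≡0 = A≢0 (trans (sym kB≡A) (trans (cong (_* B) k≡0) (ℚₚ.*-zeroˡ B)))
    exchange : ∀ x y z → (x * y) * z ≡ (x * z) * y
    exchange = solve-∀ ℚ-ring
    reassoc : ∀ x y z → (x * y) * z ≡ x * (z * y)
    reassoc = solve-∀ ℚ-ring

-- Upper indices modulo n, and the functions τ, σ̄ and κ

module _ {n : ℕ} .{{_ : ℕ.NonZero n}} where
  open import Data.Rational using (_+_; _*_)
  open ≡-Reasoning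

  residue-unique : ∀ {r₁ r₂} d → r₁ ℕ.< n → r₂ ℕ.< n → + r₁ ℤ.- + r₂ ≡ d ℤ.* + n → r₁ ≡ r₂
  residue-unique {r₁} {r₂} d r₁<n r₂<n r₁-r₂≡dn = ℤₚ.+-injective (ℤₚ.i-j≡0⇒i≡j (+ r₁) (+ r₂)
    (trans r₁-r₂≡dn (cong (ℤ._* + n) (ℤₚ.∣i∣≡0⇒i≡0 {d} (below-n⇒0 ℤ.∣ d ∣ ∣d∣*n<n)))))
    where
    below-n⇒0 : ∀ m → m ℕ.* n ℕ.< n → m ≡ 0
    below-n⇒0 zero    _    = refl
    below-n⇒0 (suc m) mn<n = ⊥-elim (ℕₚ.<⇒≱ mn<n (ℕₚ.m≤m+n n (m ℕ.* n)))
    ∣d∣*n<n : ℤ.∣ d ∣ ℕ.* n ℕ.< n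
    ∣d∣*n<n = ℕₚ.≤-<-trans (ℕₚ.≤-reflexive (begin
      ℤ.∣ d ∣ ℕ.* n           ≡⟨ ℤₚ.abs-* d (+ n) ⟨
      ℤ.∣ d ℤ.* + n ∣         ≡⟨ cong ℤ.∣_∣ r₁-r₂≡dn ⟨
      ℤ.∣ + r₁ ℤ.- + r₂ ∣     ≡⟨ cong ℤ.∣_∣ (ℤₚ.m-n≡m⊖n r₁ r₂) ⟩
      ℤ.∣ r₁ ⊖ r₂ ∣           ∎))
      (ℕₚ.≤-<-trans (ℤₚ.∣m⊝n∣≤m⊔n r₁ r₂) (ℕₚ.⊔-pres-<m r₁<n r₂<n))

  %ℕ-periodic : ∀ a q → (a ℤ.+ q ℤ.* + n) %ℕ n ≡ a %ℕ n
  %ℕ-periodic a q = residue-unique (a /ℕ n ℤ.+ q ℤ.- b /ℕ n) (n%ℕd<d b n) (n%ℕd<d a n) (begin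
    + (b %ℕ n) ℤ.- + (a %ℕ n)
      ≡⟨ isolate (+ (b %ℕ n)) (b /ℕ n) (+ (a %ℕ n)) (+ n) ⟩
    (+ (b %ℕ n) ℤ.+ b /ℕ n ℤ.* + n) ℤ.- b /ℕ n ℤ.* + n ℤ.- + (a %ℕ n)
      ≡⟨ cong (λ z → z ℤ.- b /ℕ n ℤ.* + n ℤ.- + (a %ℕ n)) (a≡a%ℕn+[a/ℕn]*n b n) ⟨
    (a ℤ.+ q ℤ.* + n) ℤ.- b /ℕ n ℤ.* + n ℤ.- + (a %ℕ n)
      ≡⟨ cong (λ z → (z ℤ.+ q ℤ.* + n) ℤ.- b /ℕ n ℤ.* + n ℤ.- + (a %ℕ n)) (a≡a%ℕn+[a/ℕn]*n a n) ⟩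
    ((+ (a %ℕ n) ℤ.+ a /ℕ n ℤ.* + n) ℤ.+ q ℤ.* + n) ℤ.- b /ℕ n ℤ.* + n ℤ.- + (a %ℕ n)
      ≡⟨ collect (+ (a %ℕ n)) (a /ℕ n) q (b /ℕ n) (+ n) ⟩
    (a /ℕ n ℤ.+ q ℤ.- b /ℕ n) ℤ.* + n ∎)
    where
    b = a ℤ.+ q ℤ.* + n
    isolate : ∀ ρ d ρ′ m → ρ ℤ.- ρ′ ≡ (ρ ℤ.+ d ℤ.* m) ℤ.- d ℤ.* m ℤ.- ρ′
    isolate = ℤ-Solver.solve-∀
    collect : ∀ ρ d q d′ m → ((ρ ℤ.+ d ℤ.* m) ℤ.+ q ℤ.* m) ℤ.- d′ ℤ.* m ℤ.- ρ ≡ (d ℤ.+ q ℤ.- d′) ℤ.* m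
    collect = ℤ-Solver.solve-∀

  at-cong-mod : ∀ (v : Pt n) {a b} → a ≡ b mod n → at v a ≡ at v b
  at-cong-mod v {b = b} (mod-witness q refl) = cong v (Finₚ.fromℕ<-cong _ _ (%ℕ-periodic b q) _ _)

  τ-cong-mod : ∀ (vs : List (Pt n)) k {r s} → r ≡ s mod n → τ n vs k r ≡ τ n vs k s
  τ-cong-mod []       zero    r≡s = refl
  τ-cong-mod []       (suc k) r≡s = refl
  τ-cong-mod (v ∷ vs) k       r≡s = sumℕ-cong (suc (k ⊓ (n ∸ 1))) (λ c _ → cong₂ _*_
    (prodℕ-cong c (λ t _ → at-cong-mod v (+-cong-mod (ℤ.- + t) r≡s)))
    (τ-cong-mod vs (k ∸ c) (+-cong-mod (ℤ.- + c) r≡s)))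

  σ̄-cong-mod : ∀ vs w k {r s} → r ≡ s mod n → σ̄ n vs w k r ≡ σ̄ n vs w k s
  σ̄-cong-mod vs w k r≡s = sumℕ-cong (suc k) (λ i _ → cong₂ _*_
    (τ-cong-mod vs (k ∸ i) r≡s)
    (prodℕ-cong i (λ u _ →
      at-cong-mod w (+-cong-mod (ℤ.- + u) (+-cong-mod (+ i) (+-cong-mod (ℤ.- + k) r≡s))))))

  κ-cong-mod : ∀ a b {r s} → r ≡ s mod n → κ n r a b ≡ κ n s a b
  κ-cong-mod a b r≡s = sumℕ-cong n (λ t _ → cong₂ _*_
    (prodℕ-cong t (λ u _ → at-cong-mod b (+-cong-mod (+ u) (+-cong-mod (+ 1) r≡s))))
    (prodℕ-cong (n ∸ 1 ∸ t) (λ u _ →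
      at-cong-mod a (+-cong-mod (+ u) (+-cong-mod (+ 1) (+-cong-mod (+ t) r≡s))))))

  -- Defs gives the coordinates of η only at the residues 0, …, n − 1.
  η₁-at : ∀ a b r → at (proj₁ (η n a b)) r ≡ (at b (r ℤ.+ + 1) * κ n (r ℤ.+ + 1) a b) ÷ κ n r a b
  η₁-at a b r = cong₂ _÷_
    (cong₂ _*_ (at-cong-mod b (+-cong-mod (+ 1) r₀≡r)) (κ-cong-mod a b (+-cong-mod (+ 1) r₀≡r)))
    (κ-cong-mod a b r₀≡r)
    where
    cancel : ∀ ρ d m → ρ ≡ (ρ ℤ.+ d ℤ.* m) ℤ.+ ℤ.- d ℤ.* m
    cancel = ℤ-Solver.solve-∀
    r₀≡r : + toℕ (fromℕ< (n%ℕd<d r n)) ≡ r mod n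
    r₀≡r = mod-witness (ℤ.- (r /ℕ n)) (begin
      + toℕ (fromℕ< (n%ℕd<d r n))
        ≡⟨ cong +_ (Finₚ.toℕ-fromℕ< (n%ℕd<d r n)) ⟩
      + (r %ℕ n)
        ≡⟨ cancel (+ (r %ℕ n)) (r /ℕ n) (+ n) ⟩
      (+ (r %ℕ n) ℤ.+ r /ℕ n ℤ.* + n) ℤ.+ ℤ.- (r /ℕ n) ℤ.* + n
        ≡⟨ cong (ℤ._+ ℤ.- (r /ℕ n) ℤ.* + n) (a≡a%ℕn+[a/ℕn]*n r n) ⟨
      r ℤ.+ ℤ.- (r /ℕ n) ℤ.* + n ∎)

  NonNegativePt PositivePt : Pt n → Set
  NonNegativePt v = ∀ c → NonNegative (v c)
  PositivePt    v = ∀ c → Positive (v c)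

  τ-degree-zero : ∀ vs r → τ n vs 0 r ≡ 1ℚ
  τ-degree-zero []       r = refl
  τ-degree-zero (v ∷ vs) r rewrite τ-degree-zero vs (r ℤ.- + 0) = refl

  τ-nonNegative : ∀ {vs} k r → All NonNegativePt vs → NonNegative (τ n vs k r)
  τ-nonNegative {[]}     zero    r [] = _
  τ-nonNegative {[]}     (suc k) r [] = _
  τ-nonNegative {v ∷ vs} k       r (v≥0 ∷ vs≥0) = sumℕ-nonNegative (suc (k ⊓ (n ∸ 1))) (λ c →
    ℚₚ.nonNeg*nonNeg⇒nonNeg
      (prodℕ c (λ t → at v (r ℤ.- + t))) {{prodℕ-nonNegative c (λ t → v≥0 _)}}
      (τ n vs (k ∸ c) (r ℤ.- + c))       {{τ-nonNegative (k ∸ c) (r ℤ.- + c) vs≥0}})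

  σ̄-positive : ∀ {vs w} k r → All NonNegativePt vs → PositivePt w → Positive (σ̄ n vs w k r)
  σ̄-positive {vs} {w} k r vs≥0 w>0 =
    ℚₚ.nonNeg+pos⇒pos (sumℕ k term) {{sumℕ-nonNegative k term≥0}} (term k) {{term-k>0}}
    where
    W : ℕ → ℚ
    W i = prodℕ i (λ u → at w (r ℤ.- + k ℤ.+ + i ℤ.- + u))
    term : ℕ → ℚ
    term i = τ n vs (k ∸ i) r * W i
    term≥0 : ∀ i → NonNegative (term i)
    term≥0 i = ℚₚ.nonNeg*nonNeg⇒nonNeg (τ n vs (k ∸ i) r) {{τ-nonNegative (k ∸ i) r vs≥0}}
                 (W i) {{prodℕ-nonNegative i (λ u → ℚₚ.pos⇒nonNeg (at w (r ℤ.- + k ℤ.+ + i ℤ.- + u)) {{w>0 _}})}}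
    term-k≡W-k : term k ≡ W k
    term-k≡W-k = begin
      τ n vs (k ∸ k) r * W k   ≡⟨ cong (λ d → τ n vs d r * W k) (ℕₚ.n∸n≡0 k) ⟩
      τ n vs 0 r * W k         ≡⟨ cong (_* W k) (τ-degree-zero vs r) ⟩
      1ℚ * W k                 ≡⟨ ℚₚ.*-identityˡ (W k) ⟩
      W k                      ∎
    term-k>0 : Positive (term k)
    term-k>0 = subst Positive (sym term-k≡W-k) (prodℕ-positive k (λ u → w>0 _))

  τ-above-top : ∀ vs k r → length vs ℕ.* (n ∸ 1) ℕ.< k → τ n vs k r ≡ 0ℚ
  τ-above-top []       (suc k) r _   = refl
  τ-above-top (v ∷ vs) k       r L<k = sumℕ-zero (suc (k ⊓ (n ∸ 1))) (λ c c<1+k⊓n → trans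
    (cong (prodℕ c (λ t → at v (r ℤ.- + t)) *_)
      (τ-above-top vs (k ∸ c) (r ℤ.- + c)
        (below (ℕₚ.≤-trans (ℕₚ.≤-pred c<1+k⊓n) (ℕₚ.m⊓n≤n k (n ∸ 1))))))
    (ℚₚ.*-zeroʳ (prodℕ c (λ t → at v (r ℤ.- + t)))))
    where
    L = length vs ℕ.* (n ∸ 1)
    below : ∀ {c} → c ℕ.≤ n ∸ 1 → L ℕ.< k ∸ c
    below {c} c≤n-1 = ℕₚ.m+n≤o⇒m≤o∸n (suc L) (ℕₚ.≤-trans (ℕₚ.+-monoʳ-≤ (suc L) c≤n-1)
      (subst (ℕ._≤ k) (cong suc (ℕₚ.+-comm (n ∸ 1) L)) L<k))

  σ̄-suc : ∀ vs w k r → σ̄ n vs w (suc k) r ≡ τ n vs (suc k) r + σ̄ n vs w k r * at w (r ℤ.- + k)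
  σ̄-suc vs w k r = begin
    σ̄ n vs w (suc k) r
      ≡⟨ sumℕ-first (suc k) _ ⟩
    τ n vs (suc k) r * 1ℚ + sumℕ (suc k) (λ i → τ n vs (k ∸ i) r * prodℕ (suc i) (W′ i))
      ≡⟨ cong₂ _+_ (ℚₚ.*-identityʳ (τ n vs (suc k) r)) (sumℕ-cong (suc k) (λ i _ → peel i)) ⟩
    τ n vs (suc k) r + sumℕ (suc k) (λ i → (τ n vs (k ∸ i) r * W i) * at w (r ℤ.- + k))
      ≡⟨ cong (λ z → τ n vs (suc k) r + z) (*-distribʳ-sumℕ (at w (r ℤ.- + k)) (suc k) _) ⟨
    τ n vs (suc k) r + σ̄ n vs w k r * at w (r ℤ.- + k) ∎
    where
    W′ : ℕ → ℕ → ℚ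
    W′ i u = at w (r ℤ.- + suc k ℤ.+ + suc i ℤ.- + u)
    W : ℕ → ℚ
    W i = prodℕ i (λ u → at w (r ℤ.- + k ℤ.+ + i ℤ.- + u))
    shift : ∀ r k i u → r ℤ.- (+ 1 ℤ.+ k) ℤ.+ (+ 1 ℤ.+ i) ℤ.- u ≡ r ℤ.- k ℤ.+ i ℤ.- u
    shift = ℤ-Solver.solve-∀
    last : ∀ r k i → r ℤ.- (+ 1 ℤ.+ k) ℤ.+ (+ 1 ℤ.+ i) ℤ.- i ≡ r ℤ.- k
    last = ℤ-Solver.solve-∀
    peel : ∀ i → τ n vs (k ∸ i) r * prodℕ (suc i) (W′ i) ≡ (τ n vs (k ∸ i) r * W i) * at w (r ℤ.- + k)
    peel i = trans
      (cong (τ n vs (k ∸ i) r *_) (cong₂ _*_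
        (prodℕ-cong i (λ u _ → cong (at w) (shift r (+ k) (+ i) (+ u))))
        (cong (at w) (last r (+ k) (+ i)))))
      (sym (ℚₚ.*-assoc (τ n vs (k ∸ i) r) (W i) (at w (r ℤ.- + k))))

  σ̄-above-top : ∀ vs w {K} s → length vs ℕ.* (n ∸ 1) ℕ.≤ K → ∀ t →
    σ̄ n vs w (t ℕ.+ K) s ≡ σ̄ n vs w K s * prodℕ t (λ u → at w (s ℤ.- + K ℤ.- + u))
  σ̄-above-top vs w {K} s top zero    = sym (ℚₚ.*-identityʳ _)
  σ̄-above-top vs w {K} s top (suc t) = begin
    σ̄ n vs w (suc (t ℕ.+ K)) s
      ≡⟨ σ̄-suc vs w (t ℕ.+ K) s ⟩
    τ n vs (suc (t ℕ.+ K)) s + σ̄ n vs w (t ℕ.+ K) s * at w (s ℤ.- + (t ℕ.+ K))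
      ≡⟨ cong₂ _+_ (τ-above-top vs _ s (s≤s (ℕₚ.≤-trans top (ℕₚ.m≤n+m K t))))
                   (cong₂ _*_ (σ̄-above-top vs w s top t) (cong (at w) index)) ⟩
    0ℚ + (σ̄ n vs w K s * P t) * at w (s ℤ.- + K ℤ.- + t)
      ≡⟨ ℚₚ.+-identityˡ _ ⟩
    (σ̄ n vs w K s * P t) * at w (s ℤ.- + K ℤ.- + t)
      ≡⟨ ℚₚ.*-assoc (σ̄ n vs w K s) (P t) _ ⟩
    σ̄ n vs w K s * P (suc t) ∎
    where
    P : ℕ → ℚ
    P t = prodℕ t (λ u → at w (s ℤ.- + K ℤ.- + u))
    split : ∀ s t K → s ℤ.- (t ℤ.+ K) ≡ s ℤ.- K ℤ.- t
    split = ℤ-Solver.solve-∀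
    index : s ℤ.- + (t ℕ.+ K) ≡ s ℤ.- + K ℤ.- + t
    index = trans (cong (λ z → s ℤ.- z) (ℤₚ.pos-+ t K)) (split s (+ t) (+ K))

  σ̄-∷ : ∀ v vs w {k} r → n ∸ 1 ℕ.≤ k →
    σ̄ n (v ∷ vs) w k r
      ≡ sumℕ (suc (n ∸ 1)) (λ c → prodℕ c (λ t → at v (r ℤ.- + t)) * σ̄ n vs w (k ∸ c) (r ℤ.- + c))
  σ̄-∷ v vs w {k} r n-1≤k = begin
    sumℕ (suc k) (λ a → τ n (v ∷ vs) (k ∸ a) r * W a)
      ≡⟨ sumℕ-cong (suc k) (λ a _ → *-distribʳ-sumℕ (W a) (suc ((k ∸ a) ⊓ (n ∸ 1))) _) ⟩
    sumℕ (suc k) (λ a → sumℕ (suc ((k ∸ a) ⊓ (n ∸ 1))) (λ c → term a c))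
      ≡⟨ sumℕ-triangle k term n-1≤k ⟩
    sumℕ (suc (n ∸ 1)) (λ c → sumℕ (suc (k ∸ c)) (λ a → term a c))
      ≡⟨ sumℕ-cong (suc (n ∸ 1)) (λ c c<n → trans
           (sumℕ-cong (suc (k ∸ c)) (λ a _ → regroup (ℕₚ.≤-trans (ℕₚ.≤-pred c<n) n-1≤k) a))
           (sym (*-distribˡ-sumℕ (V c) (suc (k ∸ c)) _))) ⟩
    sumℕ (suc (n ∸ 1)) (λ c → V c * σ̄ n vs w (k ∸ c) (r ℤ.- + c)) ∎
    where
    V : ℕ → ℚ
    V c = prodℕ c (λ t → at v (r ℤ.- + t))
    W : ℕ → ℚ
    W a = prodℕ a (λ u → at w (r ℤ.- + k ℤ.+ + a ℤ.- + u))
    term : ℕ → ℕ → ℚ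
    term a c = (V c * τ n vs (k ∸ a ∸ c) (r ℤ.- + c)) * W a
    split : ∀ r k c → r ℤ.- k ≡ r ℤ.- c ℤ.- (k ℤ.- c)
    split = ℤ-Solver.solve-∀
    regroup : ∀ {c} → c ℕ.≤ k → ∀ a → term a c
      ≡ V c * (τ n vs (k ∸ c ∸ a) (r ℤ.- + c)
                 * prodℕ a (λ u → at w (r ℤ.- + c ℤ.- + (k ∸ c) ℤ.+ + a ℤ.- + u)))
    regroup {c} c≤k a = trans (ℚₚ.*-assoc (V c) _ (W a)) (cong (V c *_) (cong₂ _*_
      (cong (λ d → τ n vs d (r ℤ.- + c)) (∸-comm k a c))
      (prodℕ-cong a (λ u _ → cong (λ z → at w (z ℤ.+ + a ℤ.- + u))
        (trans (split r (+ k) (+ c)) (cong (λ z → r ℤ.- + c ℤ.- z) (sym (pos-∸ c≤k))))))))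
      where
      ∸-comm : ∀ k a c → k ∸ a ∸ c ≡ k ∸ c ∸ a
      ∸-comm k a c = trans (ℕₚ.∸-+-assoc k a c) (trans (cong (k ∸_) (ℕₚ.+-comm a c)) (sym (ℕₚ.∸-+-assoc k c a)))

  κ-telescope : ∀ a b (B c : ℤ → ℚ) → (∀ s → at b s * B (s ℤ.- + 1) ≡ c s * B s) → ∀ s →
    κ n s a b * B s
      ≡ sumℕ n (λ t → (prodℕ t (λ u → c (s ℤ.+ + 1 ℤ.+ + u)) * B (s ℤ.+ + t))
                       * prodℕ (n ∸ 1 ∸ t) (λ u → at a (s ℤ.+ + t ℤ.+ + 1 ℤ.+ + u)))
  κ-telescope a b B c ratio s = begin
    κ n s a b * B s
      ≡⟨ *-distribʳ-sumℕ (B s) n _ ⟩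
    sumℕ n (λ t → (Pb t * Pa t) * B s)
      ≡⟨ sumℕ-cong n (λ t _ → trans (exchange (Pb t) (Pa t) (B s)) (cong (_* Pa t) (telescoped t))) ⟩
    sumℕ n (λ t → (prodℕ t (λ u → c (s ℤ.+ + 1 ℤ.+ + u)) * B (s ℤ.+ + t)) * Pa t) ∎
    where
    Pb Pa : ℕ → ℚ
    Pb t = prodℕ t (λ u → at b (s ℤ.+ + 1 ℤ.+ + u))
    Pa t = prodℕ (n ∸ 1 ∸ t) (λ u → at a (s ℤ.+ + t ℤ.+ + 1 ℤ.+ + u))
    exchange : ∀ x y z → (x * y) * z ≡ (x * z) * y
    exchange = solve-∀ ℚ-ring
    back : ∀ s u → s ℤ.+ u ≡ s ℤ.+ + 1 ℤ.+ u ℤ.- + 1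
    back = ℤ-Solver.solve-∀
    forth : ∀ s u → s ℤ.+ + 1 ℤ.+ u ≡ s ℤ.+ (+ 1 ℤ.+ u)
    forth = ℤ-Solver.solve-∀
    step : ∀ u → at b (s ℤ.+ + 1 ℤ.+ + u) * B (s ℤ.+ + u)
               ≡ c (s ℤ.+ + 1 ℤ.+ + u) * B (s ℤ.+ + suc u)
    step u = begin
      at b (s ℤ.+ + 1 ℤ.+ + u) * B (s ℤ.+ + u)
        ≡⟨ cong (λ z → at b (s ℤ.+ + 1 ℤ.+ + u) * B z) (back s (+ u)) ⟩
      at b (s ℤ.+ + 1 ℤ.+ + u) * B (s ℤ.+ + 1 ℤ.+ + u ℤ.- + 1)
        ≡⟨ ratio (s ℤ.+ + 1 ℤ.+ + u) ⟩
      c (s ℤ.+ + 1 ℤ.+ + u) * B (s ℤ.+ + 1 ℤ.+ + u)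
        ≡⟨ cong (λ z → c (s ℤ.+ + 1 ℤ.+ + u) * B z) (forth s (+ u)) ⟩
      c (s ℤ.+ + 1 ℤ.+ + u) * B (s ℤ.+ + suc u) ∎
    telescoped : ∀ t → Pb t * B s ≡ prodℕ t (λ u → c (s ℤ.+ + 1 ℤ.+ + u)) * B (s ℤ.+ + t)
    telescoped t = trans (cong (λ z → Pb t * B z) (sym (ℤₚ.+-identityʳ s))) (prodℕ-telescope step t)

  sAct-self : ∀ k (z : Config n) → sAct n k z k ≡ proj₁ (η n (z k) (z (suc k)))
  sAct-self k z with k ℕ.≟ k
  ... | yes _   = refl
  ... | no  k≢k = ⊥-elim (k≢k refl)

  sAct-below : ∀ k (z : Config n) {p} → p ℕ.< k → sAct n k z p ≡ z p
  sAct-below k z {p} p<k with p ℕ.≟ k | p ℕ.≟ suc k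
  ... | yes p≡k | _         = ⊥-elim (ℕₚ.<⇒≢ p<k p≡k)
  ... | no  _   | yes p≡1+k = ⊥-elim (ℕₚ.<⇒≢ (ℕₚ.m<n⇒m<1+n p<k) p≡1+k)
  ... | no  _   | no  _     = refl

  actWord-seg-below : ∀ lo K (z : Config n) {p} → p ℕ.< lo → actWord n (seg lo K) z p ≡ z p
  actWord-seg-below lo zero    z p<lo = refl
  actWord-seg-below lo (suc K) z p<lo =
    trans (sAct-below lo _ p<lo) (actWord-seg-below (suc lo) K z (ℕₚ.m<n⇒m<1+n p<lo))

-- Chains x_i, …, x_j

module _ (n′ : ℕ) where
  open import Data.Rational using (_+_; _*_)
  open ≡-Reasoning

  private
    n : ℕ
    n = suc n′

  σ̄-∷-top-summand : ∀ v vs w {K} s → length vs ≡ K → ∀ {t} → t ℕ.≤ n′ →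
    prodℕ (n′ ∸ t) (λ u → at v (s ℤ.- + 1 ℤ.- + u))
      * σ̄ n vs w (n′ ℕ.* suc K ∸ (n′ ∸ t)) (s ℤ.- + 1 ℤ.- + (n′ ∸ t))
    ≡ (prodℕ t (λ u → at w (s ℤ.+ + 1 ℤ.+ + u ℤ.+ + K)) * σ̄ n vs w (n′ ℕ.* K) (s ℤ.+ + t))
      * prodℕ (n′ ∸ t) (λ u → at v (s ℤ.+ + t ℤ.+ + 1 ℤ.+ + u))
  σ̄-∷-top-summand v vs w {K} s |vs|≡K {t} t≤n′ = begin
    V * σ̄ n vs w (n′ ℕ.* suc K ∸ (n′ ∸ t)) s′
      ≡⟨ cong (λ k → V * σ̄ n vs w k s′) (*-suc-∸-∸ n′ K t≤n′) ⟩
    V * σ̄ n vs w (t ℕ.+ n′ ℕ.* K) s′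
      ≡⟨ cong (V *_) (σ̄-above-top vs w s′ top t) ⟩
    V * (σ̄ n vs w (n′ ℕ.* K) s′ * prodℕ t (λ u → at w (s′ ℤ.- + (n′ ℕ.* K) ℤ.- + u)))
      ≡⟨ cong₂ (λ a b → a * b) v-run (cong₂ _*_ (σ̄-cong-mod vs w (n′ ℕ.* K) σ̄-index) w-run) ⟩
    Vrun * (σ̄ n vs w (n′ ℕ.* K) (s ℤ.+ + t) * Wrun)
      ≡⟨ rearrange Vrun _ Wrun ⟩
    (Wrun * σ̄ n vs w (n′ ℕ.* K) (s ℤ.+ + t)) * Vrun ∎
    where
    s′ = s ℤ.- + 1 ℤ.- + (n′ ∸ t)
    V Vrun Wrun : ℚ
    V    = prodℕ (n′ ∸ t) (λ u → at v (s ℤ.- + 1 ℤ.- + u))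
    Vrun = prodℕ (n′ ∸ t) (λ u → at v (s ℤ.+ + t ℤ.+ + 1 ℤ.+ + u))
    Wrun = prodℕ t (λ u → at w (s ℤ.+ + 1 ℤ.+ + u ℤ.+ + K))
    rearrange : ∀ x y z → x * (y * z) ≡ (z * y) * x
    rearrange = solve-∀ ℚ-ring
    top : length vs ℕ.* n′ ℕ.≤ n′ ℕ.* K
    top = ℕₚ.≤-reflexive (trans (cong (ℕ._* n′) |vs|≡K) (ℕₚ.*-comm K n′))
    d≡ : + (n′ ∸ t) ≡ + n′ ℤ.- + t
    d≡ = pos-∸ t≤n′
    σ̄-shift : ∀ s d t → s ℤ.- + 1 ℤ.- (d ℤ.- t) ≡ (s ℤ.+ t) ℤ.+ ℤ.- + 1 ℤ.* (+ 1 ℤ.+ d)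
    σ̄-shift = ℤ-Solver.solve-∀
    v-shift : ∀ s d t u → s ℤ.- + 1 ℤ.- (d ℤ.- t) ℤ.+ + 1 ℤ.+ u
                            ≡ (s ℤ.+ t ℤ.+ + 1 ℤ.+ u) ℤ.+ ℤ.- + 1 ℤ.* (+ 1 ℤ.+ d)
    v-shift = ℤ-Solver.solve-∀
    w-shift : ∀ s d t K u → s ℤ.- + 1 ℤ.- (d ℤ.- t) ℤ.- d ℤ.* K ℤ.- t ℤ.+ + 1 ℤ.+ u
                              ≡ (s ℤ.+ + 1 ℤ.+ u ℤ.+ K) ℤ.+ ℤ.- (+ 1 ℤ.+ K) ℤ.* (+ 1 ℤ.+ d)
    w-shift = ℤ-Solver.solve-∀
    σ̄-index : s′ ≡ s ℤ.+ + t mod n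
    σ̄-index = mod-witness (ℤ.- + 1)
      (trans (cong (λ z → s ℤ.- + 1 ℤ.- z) d≡) (σ̄-shift s (+ n′) (+ t)))
    v-index : ∀ u → s′ ℤ.+ + 1 ℤ.+ + u ≡ s ℤ.+ + t ℤ.+ + 1 ℤ.+ + u mod n
    v-index u = mod-witness (ℤ.- + 1)
      (trans (cong (λ z → s ℤ.- + 1 ℤ.- z ℤ.+ + 1 ℤ.+ + u) d≡) (v-shift s (+ n′) (+ t) (+ u)))
    w-index : ∀ u → s′ ℤ.- + (n′ ℕ.* K) ℤ.- + t ℤ.+ + 1 ℤ.+ + u ≡ s ℤ.+ + 1 ℤ.+ + u ℤ.+ + K mod n
    w-index u = mod-witness (ℤ.- (+ 1 ℤ.+ + K))
      (trans (cong₂ (λ z y → s ℤ.- + 1 ℤ.- z ℤ.- y ℤ.- + t ℤ.+ + 1 ℤ.+ + u) d≡ (ℤₚ.pos-* n′ K))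
             (w-shift s (+ n′) (+ t) (+ K) (+ u)))
    v-run : V ≡ Vrun
    v-run = trans (prodℕ-descending (at v) (n′ ∸ t) (s ℤ.- + 1))
                  (prodℕ-cong (n′ ∸ t) (λ u _ → at-cong-mod v (v-index u)))
    w-run : prodℕ t (λ u → at w (s′ ℤ.- + (n′ ℕ.* K) ℤ.- + u)) ≡ Wrun
    w-run = trans (prodℕ-descending (at w) t (s′ ℤ.- + (n′ ℕ.* K)))
                  (prodℕ-cong t (λ u _ → at-cong-mod w (w-index u)))

  σ̄-∷-top : ∀ v vs w {K} s → length vs ≡ K →
    σ̄ n (v ∷ vs) w (n′ ℕ.* suc K) (s ℤ.- + 1)
      ≡ sumℕ n (λ t → (prodℕ t (λ u → at w (s ℤ.+ + 1 ℤ.+ + u ℤ.+ + K)) * σ̄ n vs w (n′ ℕ.* K) (s ℤ.+ + t))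
                       * prodℕ (n′ ∸ t) (λ u → at v (s ℤ.+ + t ℤ.+ + 1 ℤ.+ + u)))
  σ̄-∷-top v vs w {K} s |vs|≡K = begin
    σ̄ n (v ∷ vs) w (n′ ℕ.* suc K) (s ℤ.- + 1)
      ≡⟨ σ̄-∷ v vs w (s ℤ.- + 1) (ℕₚ.m≤m*n n′ (suc K)) ⟩
    sumℕ n (λ c → V c * σ̄ n vs w (n′ ℕ.* suc K ∸ c) (s ℤ.- + 1 ℤ.- + c))
      ≡⟨ sumℕ-reverse n _ ⟩
    sumℕ n (λ t → V (n′ ∸ t) * σ̄ n vs w (n′ ℕ.* suc K ∸ (n′ ∸ t)) (s ℤ.- + 1 ℤ.- + (n′ ∸ t)))
      ≡⟨ sumℕ-cong n (λ t t<n → σ̄-∷-top-summand v vs w s |vs|≡K (ℕₚ.≤-pred t<n)) ⟩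
    sumℕ n (λ t → (prodℕ t (λ u → at w (s ℤ.+ + 1 ℤ.+ + u ℤ.+ + K)) * σ̄ n vs w (n′ ℕ.* K) (s ℤ.+ + t))
                   * prodℕ (n′ ∸ t) (λ u → at v (s ℤ.+ + t ℤ.+ + 1 ℤ.+ + u))) ∎
    where
    V : ℕ → ℚ
    V c = prodℕ c (λ u → at v (s ℤ.- + 1 ℤ.- + u))

  module _ (x : Config n) where

    -- σ̄chain i j (j − i) r is the paper's σ̄^{(r)}_{(n−1)(j−i)}(x_i, …, x_j).
    σ̄chain : ℕ → ℕ → ℕ → ℤ → ℚ
    σ̄chain i j K r = σ̄ n (map x (seg i K)) (x j) (n′ ℕ.* K) r

    PositiveOn : ℕ → ℕ → Set
    PositiveOn i j = ∀ p → i ℕ.≤ p → p ℕ.≤ j → PositivePt (x p)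

    length-seg : ∀ i K → length (map x (seg i K)) ≡ K
    length-seg i zero    = refl
    length-seg i (suc K) = cong suc (length-seg (suc i) K)

    seg-All : ∀ {P : Pt n → Set} i K → (∀ p → i ℕ.≤ p → p ℕ.< K ℕ.+ i → P (x p)) → All P (map x (seg i K))
    seg-All i zero    _  = []
    seg-All i (suc K) Px = Px i ℕₚ.≤-refl (s≤s (ℕₚ.m≤n+m i K))
      ∷ seg-All (suc i) K (λ p i<p p<K+1+i → Px p (ℕₚ.<⇒≤ i<p) (subst (p ℕ.<_) (ℕₚ.+-suc K i) p<K+1+i))

    σ̄chain-positive : ∀ K {i j} r → K ℕ.+ i ≡ j → PositiveOn i j → Positive (σ̄chain i j K r)
    σ̄chain-positive K {i} {j} r K+i≡j x>0 = σ̄-positive {w = x j} (n′ ℕ.* K) r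
      (All.map (λ {v} v>0 c → ℚₚ.pos⇒nonNeg (v c) {{v>0 c}})
        (seg-All {PositivePt} i K (λ p i≤p p<K+i → x>0 p i≤p (ℕₚ.<⇒≤ (subst (p ℕ.<_) K+i≡j p<K+i)))))
      (x>0 j (subst (i ℕ.≤_) K+i≡j (ℕₚ.m≤n+m i K)) ℕₚ.≤-refl)

    σ̄chain-empty : ∀ i j r → σ̄chain i j 0 r ≡ 1ℚ
    σ̄chain-empty i j r rewrite ℕₚ.*-zeroʳ n′ = refl

    coordinate-cleared : ∀ K {i j} → K ℕ.+ i ≡ j → PositiveOn i j → ∀ r →
      at (actWord n (seg i K) x i) r * σ̄chain i j K (r ℤ.- + 1) ≡ at (x j) (r ℤ.+ + K) * σ̄chain i j K r
    κ-cleared : ∀ K {i j} → K ℕ.+ suc i ≡ j → PositiveOn (suc i) j → ∀ s →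
      κ n s (x i) (actWord n (seg (suc i) K) x (suc i)) * σ̄chain (suc i) j K s
        ≡ σ̄chain i j (suc K) (s ℤ.- + 1)

    coordinate-cleared zero {i} refl _ r = cong₂ _*_
      (cong (at (x i)) (sym (ℤₚ.+-identityʳ r)))
      (trans (σ̄chain-empty i i (r ℤ.- + 1)) (sym (σ̄chain-empty i i r)))
    coordinate-cleared (suc K) {i} {j} 1+K+i≡j x>0 r = begin
      at (actWord n (seg i (suc K)) x i) r * A (r ℤ.- + 1)
        ≡⟨ cong (λ v → at v r * A (r ℤ.- + 1)) first-component ⟩
      at (proj₁ (η n (x i) y)) r * A (r ℤ.- + 1)
        ≡⟨ cong (_* A (r ℤ.- + 1)) (η₁-at (x i) y r) ⟩
      ((at y (r ℤ.+ + 1) * κ n (r ℤ.+ + 1) (x i) y) ÷ κ n r (x i) y) * A (r ℤ.- + 1)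
        ≡⟨ ratio-transfer {at y (r ℤ.+ + 1)} {at (x j) (r ℤ.+ + 1 ℤ.+ + K)}
             {κ n r (x i) y} {κ n (r ℤ.+ + 1) (x i) y} {B r} {B (r ℤ.+ + 1)}
             (positive⇒≢0 (σ̄chain-positive (suc K) (r ℤ.- + 1) 1+K+i≡j x>0))
             (κ-cleared K K+1+i≡j x>0′ r) (κ-cleared K K+1+i≡j x>0′ (r ℤ.+ + 1)) y-ratio ⟩
      at (x j) (r ℤ.+ + 1 ℤ.+ + K) * A (r ℤ.+ + 1 ℤ.- + 1)
        ≡⟨ cong₂ (λ a b → at (x j) a * A b) (reassoc r (+ K)) (cancel r) ⟩
      at (x j) (r ℤ.+ + suc K) * A r ∎
      where
      y = actWord n (seg (suc i) K) x (suc i)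
      A = σ̄chain i j (suc K)
      B = σ̄chain (suc i) j K
      K+1+i≡j : K ℕ.+ suc i ≡ j
      K+1+i≡j = trans (ℕₚ.+-suc K i) 1+K+i≡j
      x>0′ : PositiveOn (suc i) j
      x>0′ p 1+i≤p = x>0 p (ℕₚ.<⇒≤ 1+i≤p)
      first-component : actWord n (seg i (suc K)) x i ≡ proj₁ (η n (x i) y)
      first-component = trans (sAct-self i (actWord n (seg (suc i) K) x))
        (cong (λ v → proj₁ (η n v y)) (actWord-seg-below (suc i) K x (ℕₚ.n<1+n i)))
      cancel : ∀ r → r ℤ.+ + 1 ℤ.- + 1 ≡ r
      cancel = ℤ-Solver.solve-∀
      reassoc : ∀ r k → r ℤ.+ + 1 ℤ.+ k ≡ r ℤ.+ (+ 1 ℤ.+ k)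
      reassoc = ℤ-Solver.solve-∀
      y-ratio : at y (r ℤ.+ + 1) * B r ≡ at (x j) (r ℤ.+ + 1 ℤ.+ + K) * B (r ℤ.+ + 1)
      y-ratio = trans (cong (λ z → at y (r ℤ.+ + 1) * B z) (sym (cancel r)))
                      (coordinate-cleared K K+1+i≡j x>0′ (r ℤ.+ + 1))

    κ-cleared K {i} {j} K+1+i≡j x>0 s =
      trans (κ-telescope (x i) y B (λ s′ → at (x j) (s′ ℤ.+ + K)) (coordinate-cleared K K+1+i≡j x>0) s)
            (sym (σ̄-∷-top (x i) (map x (seg (suc i) K)) (x j) s (length-seg (suc i) K)))
      where
      y = actWord n (seg (suc i) K) x (suc i)
      B = σ̄chain (suc i) j K

    κ-formula : ∀ K {i j} → K ℕ.+ suc i ≡ j → PositiveOn (suc i) j → ∀ s →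
      κ n s (x i) (actWord n (seg (suc i) K) x (suc i)) ≡ σ̄chain i j (suc K) (s ℤ.- + 1) ÷ σ̄chain (suc i) j K s
    κ-formula K K+1+i≡j x>0 s =
      sym (÷-unique (positive⇒≢0 (σ̄chain-positive K s K+1+i≡j x>0)) (κ-cleared K K+1+i≡j x>0 s))

    coordinate-formula : ∀ K {i j} → K ℕ.+ i ≡ j → PositiveOn i j → ∀ r →
      at (actWord n (seg i K) x i) r ≡ (at (x j) (r ℤ.+ + K) * σ̄chain i j K r) ÷ σ̄chain i j K (r ℤ.- + 1)
    coordinate-formula K K+i≡j x>0 r =
      sym (÷-unique (positive⇒≢0 (σ̄chain-positive K (r ℤ.- + 1) K+i≡j x>0)) (coordinate-cleared K K+i≡j x>0 r))

open import Data.Nat using (ℕ; _∸_; _*_; _≤_; _<_; suc; NonZero)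
open import Data.Integer using (ℤ; +_; _+_; _-_)
open import Data.Rational using (ℚ; Positive) renaming (_*_ to _*ℚ_)
open import Data.Fin using (Fin)
open import Data.Product using (_×_)
open import Relation.Binary.PropositionalEquality using (_≡_)

mainTheorem2 : (n : ℕ) .{{_ : NonZero n}} (m : ℕ) (x : Config n)
    → (∀ p → 1 ≤ p → p ≤ m → ∀ (c : Fin n) → Positive (x p c))
    → (i j : ℕ) → 1 ≤ i → i < j → j ≤ m → (r : ℤ)
    → (κ n r (x i) (actWord n (seg (suc i) (j ∸ suc i)) x (suc i))
         ≡ σ̄seg n x i j ((n ∸ 1) * (j ∸ i)) (r - + 1)
           ÷ σ̄seg n x (suc i) j ((n ∸ 1) * (j ∸ suc i)) r)
      × (at (actWord n (seg i (j ∸ i)) x i) r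
         ≡ (at (x j) (r + + (j ∸ i)) *ℚ σ̄seg n x i j ((n ∸ 1) * (j ∸ i)) r)
           ÷ σ̄seg n x i j ((n ∸ 1) * (j ∸ i)) (r - + 1))
mainTheorem2 zero {{n≢0}} m x x>0 i j 1≤i i<j j≤m r = Irrelevant.⊥-elim (ℕ.NonZero.nonZero n≢0)
mainTheorem2 (suc n′) m x x>0 i j 1≤i i<j j≤m r =
  trans (κ-formula n′ x (j ∸ suc i) (ℕₚ.m∸n+n≡m i<j) (λ p 1+i≤p → x>0ᵢⱼ p (ℕₚ.<⇒≤ 1+i≤p)) r)
        (cong (λ K → σ̄chain n′ x i j K (r - + 1) ÷ σ̄chain n′ x (suc i) j (j ∸ suc i) r) (sym j∸i≡))
  , coordinate-formula n′ x (j ∸ i) (ℕₚ.m∸n+n≡m (ℕₚ.<⇒≤ i<j)) x>0ᵢⱼ r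
  where
  j∸i≡ : j ∸ i ≡ suc (j ∸ suc i)
  j∸i≡ = ℕₚ.+-∸-assoc 1 i<j
  x>0ᵢⱼ : PositiveOn n′ x i j
  x>0ᵢⱼ p i≤p p≤j = x>0 p (ℕₚ.≤-trans 1≤i i≤p) (ℕₚ.≤-trans p≤j j≤m)
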